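{- Let $\mathcal{C}$ be a set of circuits of even length in a directed graph $G$ whose sum (symmetric difference of edge sets) is empty. Then the parity of the number of clockwise even members of $\mathcal{C}$ is independent of the orientation of $G$.
   Context: For a circuit of even length in a directed graph, its clockwise parity is the parity of the number of its edges directed in agreement with a chosen sense of traversal (independent of the chosen sense since the length is even); the circuit is clockwise even if this number is even. -}

module Defs where

open import Data.Nat using (ℕ; zero; suc; _%_)
open import Data.Nat.DivMod using (_mod_)
open import Data.Bool using (Bool; true; false; if_then_else_; _∧_)
open import Data.Fin using (Fin; toℕ; _≟_)
open import Data.Product using (_×_; _,_; proj₁; proj₂; swap)
open import Data.Sum using (_⊎_)
open import Data.List using (List; allFin; map; sum; filter; length)
open import Data.Bool.ListAction using (any)
open import Function.Definitions using (Injective)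
open import Relation.Binary.PropositionalEquality using (_≡_)
open import Relation.Nullary.Decidable using (⌊_⌋)

-- An (undirected multi)graph with vertex set Fin n and edge set Fin m:
-- each edge has an (ordered, for bookkeeping only) pair of ends.
record Graph : Set where
  field
    nV   : ℕ
    nE   : ℕ
    ends : Fin nE → Fin nV × Fin nV
open Graph public

-- An orientation of G: for each edge, true means directed proj₁ → proj₂,
-- false means directed proj₂ → proj₁.  A directed graph is a graph plus
-- an orientation.
Orientation : Graph → Set
Orientation G = Fin (nE G) → Bool

dir : (G : Graph) → Orientation G → Fin (nE G) → Fin (nV G) × Fin (nV G)
dir G o e = if o e then ends G e else swap (ends G e)

next : ∀ {ℓ} → Fin (suc ℓ) → Fin (suc ℓ)
next {ℓ} i = suc (toℕ i) mod suc ℓ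

Joins : (G : Graph) → Fin (nE G) → Fin (nV G) → Fin (nV G) → Set
Joins G e v w = (ends G e ≡ (v , w)) ⊎ (ends G e ≡ (w , v))

-- The sequence order fixes a
-- sense of traversal.
record Circuit (G : Graph) : Set where
  field
    pl     : ℕ
    verts  : Fin (suc pl) → Fin (nV G)
    edges  : Fin (suc pl) → Fin (nE G)
    vinj   : Injective _≡_ _≡_ verts
    einj   : Injective _≡_ _≡_ edges
    joins  : ∀ i → Joins G (edges i) (verts i) (verts (next i))
open Circuit public

len : ∀ {G} → Circuit G → ℕ
len c = suc (pl c)

agrees : (G : Graph) → Orientation G → (c : Circuit G) → Fin (len c) → Bool
agrees G o c i =
  ⌊ proj₁ (dir G o (edges c i)) ≟ verts c i ⌋ ∧
  ⌊ proj₂ (dir G o (edges c i)) ≟ verts c (next i) ⌋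

forwardCount : (G : Graph) → Orientation G → Circuit G → ℕ
forwardCount G o c = length (filter (λ i → agrees G o c i ≟ᵇ true) (allFin (len c)))
  where
    open import Data.Bool.Properties using () renaming (_≟_ to _≟ᵇ_)

IsEven : ℕ → Set
IsEven k = k % 2 ≡ 0

ClockwiseEven : (G : Graph) → Orientation G → Circuit G → Set
ClockwiseEven G o c = IsEven (forwardCount G o c)

inCircuit : (G : Graph) → Circuit G → Fin (nE G) → Bool
inCircuit G c e = any (λ i → ⌊ edges c i ≟ e ⌋) (allFin (len c))

countClockwiseEven : (G : Graph) → Orientation G → ∀ {k} → (Fin k → Circuit G) → ℕ
countClockwiseEven G o {k} 𝒞 =
  length (filter (λ j → (forwardCount G o (𝒞 j) % 2) Data.Nat.≟ 0) (allFin k))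

multiplicity : (G : Graph) → ∀ {k} → (Fin k → Circuit G) → Fin (nE G) → ℕ
multiplicity G {k} 𝒞 e = length (filter (λ j → inCircuit G (𝒞 j) e Data.Bool.Properties.≟ true) (allFin k))
  where import Data.Bool.Properties

SumEmpty : (G : Graph) → ∀ {k} → (Fin k → Circuit G) → Set
SumEmpty G 𝒞 = ∀ e → IsEven (multiplicity G 𝒞 e)

-- members of the family are distinct circuits (distinct edge sets), so the
-- family is a set of circuits
DistinctMembers : (G : Graph) → ∀ {k} → (Fin k → Circuit G) → Set
DistinctMembers G {k} 𝒞 =
  ∀ j j′ → (∀ e → inCircuit G (𝒞 j) e ≡ inCircuit G (𝒞 j′) e) → j ≡ j′

-- Reversing the edges of a set D changes the clockwise parity of a circuit C by |C ∩ D| (mod 2):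
-- consecutive vertices of a circuit of length at least 2 are distinct, so each edge of C agrees
-- with the traversal under exactly one of its two orientations.  Summing over the family, the
-- number of clockwise even members changes by the sum over e ∈ D of the number of members
-- through e, and each of these numbers is even because the sum of the family is empty.
module Submission where

open import Defs
open import Algebra.Bundles using (CommutativeRing)
open import Data.Bool using (Bool; true; false; not; _xor_; _∧_; if_then_else_; T)
open import Data.Bool.ListAction using (any)
open import Data.Bool.Properties
  using ( ¬-not; not-involutive; T-≡; xor-same; xor-comm; xor-annihilates-not; ∧-distribʳ-xor
        ; xor-∧-commutativeRing)
  renaming (_≟_ to _≟ᵇ_)
open import Data.Fin using (Fin; toℕ; _≟_)
open import Data.Fin.Properties using (toℕ-fromℕ<; toℕ≤pred[n])
open import Data.List using (List; []; _∷_; allFin; filter; length)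
open import Data.List.Membership.Propositional.Properties using (∈-allFin)
open import Data.List.Relation.Unary.All.Properties using (All¬⇒¬Any)
import Data.List.Relation.Unary.Any as Any
open import Data.List.Relation.Unary.Any.Properties using (any⁺; any⁻)
open import Data.List.Relation.Unary.AllPairs using (_∷_)
open import Data.List.Relation.Unary.Unique.Propositional using (Unique)
open import Data.List.Relation.Unary.Unique.Propositional.Properties using (allFin⁺)
open import Data.Nat using (ℕ; zero; suc; _%_; _≤_; s≤s)
import Data.Nat as ℕ
open import Data.Nat.DivMod using (m<n⇒m%n≡m; n%n≡0)
open import Data.Nat.Properties using (1+n≢n; m≤n⇒m<n∨m≡n)
open import Data.Product using (_×_; _,_; proj₁; proj₂; swap)
open import Data.Sum using (_⊎_; inj₁; inj₂)
open import Function using (_∘_; Equivalence)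
open import Function.Definitions using (Injective)
open import Level using (Level)
open import Relation.Nullary using (¬_; Dec; yes; no; does; contradiction)
open import Relation.Nullary.Decidable using (⌊_⌋; toWitness; fromWitness; isYes≗does; dec-true; dec-false)
open import Relation.Unary using (Pred; Decidable)
open import Relation.Binary.PropositionalEquality
open ≡-Reasoning
open import Algebra.Properties.CommutativeSemigroup
  (CommutativeRing.+-commutativeSemigroup xor-∧-commutativeRing) using (interchange)

private
  variable
    a : Level
    A : Set a

isOdd : ℕ → Bool
isOdd zero    = false
isOdd (suc n) = not (isOdd n)

%2≡isOdd : ∀ n → n % 2 ≡ (if isOdd n then 1 else 0)
%2≡isOdd zero          = refl
%2≡isOdd (suc zero)    = refl
%2≡isOdd (suc (suc n)) rewrite not-involutive (isOdd n) = %2≡isOdd n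

isOdd⇒%2 : ∀ {m n} → isOdd m ≡ isOdd n → m % 2 ≡ n % 2
isOdd⇒%2 {m} {n} eq = begin
  m % 2                         ≡⟨ %2≡isOdd m ⟩
  (if isOdd m then 1 else 0)    ≡⟨ cong (if_then 1 else 0) eq ⟩
  (if isOdd n then 1 else 0)    ≡⟨ %2≡isOdd n ⟨
  n % 2                         ∎

isOdd≡false : ∀ {n} → IsEven n → isOdd n ≡ false
isOdd≡false {n} n%2≡0 with isOdd n | %2≡isOdd n
... | false | _      = refl
... | true  | n%2≡1 = contradiction (trans (sym n%2≡1) n%2≡0) λ ()

does-%2≟0 : ∀ n → does (n % 2 ℕ.≟ 0) ≡ not (isOdd n)
does-%2≟0 n with isOdd n | %2≡isOdd n
... | false | n%2≡0 rewrite n%2≡0 = refl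
... | true  | n%2≡1 rewrite n%2≡1 = refl

even-suc⇒≢0 : ∀ {ℓ} → IsEven (suc ℓ) → ℓ ≢ 0
even-suc⇒≢0 () refl

xor≡false⇒≡ : ∀ {x y} → x xor y ≡ false → x ≡ y
xor≡false⇒≡ {false} {false} _ = refl
xor≡false⇒≡ {true}  {true}  _ = refl

does-≟true : ∀ b → does (b ≟ᵇ true) ≡ b
does-≟true false = refl
does-≟true true  = refl

⨁ : List A → (A → Bool) → Bool
⨁ []       f = false
⨁ (x ∷ xs) f = f x xor ⨁ xs f

syntax ⨁ xs (λ x → b) = ⨁[ x ← xs ] b

⨁-cong : ∀ (xs : List A) {f g : A → Bool} → (∀ x → f x ≡ g x) → ⨁ xs f ≡ ⨁ xs g
⨁-cong []       f≗g = refl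
⨁-cong (x ∷ xs) f≗g = cong₂ _xor_ (f≗g x) (⨁-cong xs f≗g)

⨁-zero : ∀ (xs : List A) → ⨁[ _ ← xs ] false ≡ false
⨁-zero []       = refl
⨁-zero (_ ∷ xs) = ⨁-zero xs

⨁-xor : ∀ (xs : List A) f g → ⨁ xs f xor ⨁ xs g ≡ ⨁[ x ← xs ] (f x xor g x)
⨁-xor []       f g = refl
⨁-xor (x ∷ xs) f g = begin
  (f x xor ⨁ xs f) xor (g x xor ⨁ xs g)    ≡⟨ interchange (f x) (⨁ xs f) (g x) (⨁ xs g) ⟩
  (f x xor g x) xor (⨁ xs f xor ⨁ xs g)    ≡⟨ cong ((f x xor g x) xor_) (⨁-xor xs f g) ⟩
  (f x xor g x) xor ⨁[ y ← xs ] (f y xor g y) ∎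

⨁-∧ʳ : ∀ (xs : List A) f b → ⨁[ x ← xs ] (f x ∧ b) ≡ ⨁ xs f ∧ b
⨁-∧ʳ []       f b = refl
⨁-∧ʳ (x ∷ xs) f b = begin
  (f x ∧ b) xor ⨁[ y ← xs ] (f y ∧ b)  ≡⟨ cong ((f x ∧ b) xor_) (⨁-∧ʳ xs f b) ⟩
  (f x ∧ b) xor (⨁ xs f ∧ b)           ≡⟨ ∧-distribʳ-xor b (f x) (⨁ xs f) ⟨
  (f x xor ⨁ xs f) ∧ b                 ∎

⨁-comm : ∀ {b} {B : Set b} (xs : List A) (ys : List B) (f : A → B → Bool) →
         ⨁[ x ← xs ] ⨁[ y ← ys ] f x y ≡ ⨁[ y ← ys ] ⨁[ x ← xs ] f x y
⨁-comm []       ys f = sym (⨁-zero ys)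
⨁-comm (x ∷ xs) ys f = begin
  ⨁ ys (f x) xor ⨁[ x′ ← xs ] ⨁ ys (f x′)          ≡⟨ cong (⨁ ys (f x) xor_) (⨁-comm xs ys f) ⟩
  ⨁ ys (f x) xor ⨁[ y ← ys ] ⨁[ x′ ← xs ] f x′ y   ≡⟨ ⨁-xor ys (f x) _ ⟩
  ⨁[ y ← ys ] (f x y xor ⨁[ x′ ← xs ] f x′ y)       ∎

isOdd-length-filter : ∀ {p} {P : Pred A p} (P? : Decidable P) xs →
                      isOdd (length (filter P? xs)) ≡ ⨁[ x ← xs ] does (P? x)
isOdd-length-filter P? []       = refl
isOdd-length-filter P? (x ∷ xs) with does (P? x)
... | false = isOdd-length-filter P? xs
... | true  = cong not (isOdd-length-filter P? xs)

isOdd-count : ∀ (f : A → Bool) xs → isOdd (length (filter (λ x → f x ≟ᵇ true) xs)) ≡ ⨁ xs f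
isOdd-count f xs = trans (isOdd-length-filter _ xs) (⨁-cong xs (λ x → does-≟true (f x)))

⨁≡any : ∀ {f : A → Bool} {xs} → Unique xs → (∀ {x y} → T (f x) → T (f y) → x ≡ y) →
        ⨁ xs f ≡ any f xs
⨁≡any {xs = []}     _                 _         = refl
⨁≡any {f = f} {xs = x ∷ xs} (x∉xs ∷ unique) atMostOne with f x in fx
... | false = ⨁≡any unique atMostOne
... | true  = cong not (trans (⨁≡any unique atMostOne) (¬-not noOtherWitness))
  where
  noOtherWitness : any f xs ≢ true
  noOtherWitness any≡true = All¬⇒¬Any x∉xs
    (Any.map (atMostOne (Equivalence.from T-≡ fx)) (any⁻ f xs (Equivalence.from T-≡ any≡true)))

⨁-allFin-≟ : ∀ {n} (x : Fin n) → ⨁[ e ← allFin n ] ⌊ x ≟ e ⌋ ≡ true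
⨁-allFin-≟ {n} x = begin
  ⨁[ e ← allFin n ] ⌊ x ≟ e ⌋    ≡⟨ ⨁≡any (allFin⁺ n) (λ p q → trans (sym (toWitness p)) (toWitness q)) ⟩
  any (λ e → ⌊ x ≟ e ⌋) (allFin n) ≡⟨ Equivalence.to T-≡ (any⁺ _ (Any.map fromWitness (∈-allFin x))) ⟩
  true                             ∎

⨁-delta : ∀ {n} (x : Fin n) (h : Fin n → Bool) → ⨁[ e ← allFin n ] (⌊ x ≟ e ⌋ ∧ h e) ≡ h x
⨁-delta {n} x h = begin
  ⨁[ e ← allFin n ] (⌊ x ≟ e ⌋ ∧ h e)   ≡⟨ ⨁-cong (allFin n) onDiagonal ⟩
  ⨁[ e ← allFin n ] (⌊ x ≟ e ⌋ ∧ h x)   ≡⟨ ⨁-∧ʳ (allFin n) (λ e → ⌊ x ≟ e ⌋) (h x) ⟩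
  ⨁[ e ← allFin n ] ⌊ x ≟ e ⌋ ∧ h x     ≡⟨ cong (_∧ h x) (⨁-allFin-≟ x) ⟩
  h x                                    ∎
  where
  onDiagonal : ∀ e → ⌊ x ≟ e ⌋ ∧ h e ≡ ⌊ x ≟ e ⌋ ∧ h x
  onDiagonal e with x ≟ e
  ... | yes refl = refl
  ... | no  _    = refl

⨁-reindex : ∀ {m n} (f : Fin m → Fin n) → Injective _≡_ _≡_ f → (h : Fin n → Bool) →
            ⨁[ i ← allFin m ] h (f i) ≡ ⨁[ e ← allFin n ] (any (λ i → ⌊ f i ≟ e ⌋) (allFin m) ∧ h e)
⨁-reindex {m} {n} f f-injective h = begin
  ⨁[ i ← allFin m ] h (f i)                              ≡⟨ ⨁-cong (allFin m) (λ i → ⨁-delta (f i) h) ⟨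
  ⨁[ i ← allFin m ] ⨁[ e ← allFin n ] (⌊ f i ≟ e ⌋ ∧ h e) ≡⟨ ⨁-comm (allFin m) (allFin n) (λ i e → ⌊ f i ≟ e ⌋ ∧ h e) ⟩
  ⨁[ e ← allFin n ] ⨁[ i ← allFin m ] (⌊ f i ≟ e ⌋ ∧ h e) ≡⟨ ⨁-cong (allFin n) (λ e → ⨁-∧ʳ (allFin m) _ (h e)) ⟩
  ⨁[ e ← allFin n ] (⨁[ i ← allFin m ] ⌊ f i ≟ e ⌋ ∧ h e) ≡⟨ ⨁-cong (allFin n) (λ e → cong (_∧ h e) (preimage e)) ⟩
  ⨁[ e ← allFin n ] (any (λ i → ⌊ f i ≟ e ⌋) (allFin m) ∧ h e) ∎
  where
  preimage : ∀ e → ⨁[ i ← allFin m ] ⌊ f i ≟ e ⌋ ≡ any (λ i → ⌊ f i ≟ e ⌋) (allFin m)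
  preimage e = ⨁≡any (allFin⁺ m) (λ p q → f-injective (trans (toWitness p) (sym (toWitness q))))

[1+m]%[1+n]≢m : ∀ {m n} → m ≤ n → n ≢ 0 → suc m % suc n ≢ m
[1+m]%[1+n]≢m {m} m≤n n≢0 with m≤n⇒m<n∨m≡n m≤n
... | inj₁ m<n  = λ eq → 1+n≢n (trans (sym (m<n⇒m%n≡m (s≤s m<n))) eq)
... | inj₂ refl = λ eq → n≢0 (trans (sym eq) (n%n≡0 (suc m)))

next-≢ : ∀ {ℓ} → ℓ ≢ 0 → (i : Fin (suc ℓ)) → next i ≢ i
next-≢ ℓ≢0 i next≡i =
  [1+m]%[1+n]≢m (toℕ≤pred[n] i) ℓ≢0 (trans (sym (toℕ-fromℕ< _)) (cong toℕ next≡i))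

⌊⌋-true : ∀ {p} {P : Set p} (P? : Dec P) → P → ⌊ P? ⌋ ≡ true
⌊⌋-true P? p = trans (isYes≗does P?) (dec-true P? p)

⌊⌋-false : ∀ {p} {P : Set p} (P? : Dec P) → ¬ P → ⌊ P? ⌋ ≡ false
⌊⌋-false P? ¬p = trans (isYes≗does P?) (dec-false P? ¬p)

arcFromTo : ∀ {n} → Fin n × Fin n → Fin n → Fin n → Bool
arcFromTo a v w = ⌊ proj₁ a ≟ v ⌋ ∧ ⌊ proj₂ a ≟ w ⌋

module _ {n} {v w : Fin n} where

  arcFromTo-self : arcFromTo (v , w) v w ≡ true
  arcFromTo-self = cong₂ _∧_ (⌊⌋-true (v ≟ v) refl) (⌊⌋-true (w ≟ w) refl)

  arcFromTo-reversed : v ≢ w → arcFromTo (w , v) v w ≡ false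
  arcFromTo-reversed v≢w = cong (_∧ ⌊ v ≟ w ⌋) (⌊⌋-false (w ≟ v) (v≢w ∘ sym))

  arcFromTo-xor-swap : ∀ {a} → v ≢ w → (a ≡ (v , w)) ⊎ (a ≡ (w , v)) →
                       arcFromTo a v w xor arcFromTo (swap a) v w ≡ true
  arcFromTo-xor-swap v≢w (inj₁ refl) = cong₂ _xor_ arcFromTo-self (arcFromTo-reversed v≢w)
  arcFromTo-xor-swap v≢w (inj₂ refl) = cong₂ _xor_ (arcFromTo-reversed v≢w) arcFromTo-self

  arcFromTo-reorient : ∀ {a} → v ≢ w → (a ≡ (v , w)) ⊎ (a ≡ (w , v)) → ∀ b b′ →
    arcFromTo (if b then a else swap a) v w xor arcFromTo (if b′ then a else swap a) v w ≡ b xor b′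
  arcFromTo-reorient {a} v≢w a-joins true  true  = xor-same (arcFromTo a v w)
  arcFromTo-reorient {a} v≢w a-joins false false = xor-same (arcFromTo (swap a) v w)
  arcFromTo-reorient {a} v≢w a-joins true  false = arcFromTo-xor-swap v≢w a-joins
  arcFromTo-reorient {a} v≢w a-joins false true  =
    trans (xor-comm (arcFromTo (swap a) v w) (arcFromTo a v w)) (arcFromTo-xor-swap v≢w a-joins)

module _ (G : Graph) where

  consecutive-≢ : (c : Circuit G) → pl c ≢ 0 → ∀ i → verts c i ≢ verts c (next i)
  consecutive-≢ c pl≢0 i vᵢ≡vᵢ₊₁ = next-≢ pl≢0 i (sym (vinj c vᵢ≡vᵢ₊₁))

  agrees-xor : ∀ (o₁ o₂ : Orientation G) (c : Circuit G) → pl c ≢ 0 → ∀ i →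
               agrees G o₁ c i xor agrees G o₂ c i ≡ o₁ (edges c i) xor o₂ (edges c i)
  agrees-xor o₁ o₂ c pl≢0 i =
    arcFromTo-reorient (consecutive-≢ c pl≢0 i) (joins c i) (o₁ (edges c i)) (o₂ (edges c i))

  isOdd-forwardCount-xor : ∀ (o₁ o₂ : Orientation G) (c : Circuit G) → pl c ≢ 0 →
    isOdd (forwardCount G o₁ c) xor isOdd (forwardCount G o₂ c)
      ≡ ⨁[ e ← allFin (nE G) ] (inCircuit G c e ∧ (o₁ e xor o₂ e))
  isOdd-forwardCount-xor o₁ o₂ c pl≢0 = begin
    isOdd (forwardCount G o₁ c) xor isOdd (forwardCount G o₂ c)
      ≡⟨ cong₂ _xor_ (isOdd-count (agrees G o₁ c) positions) (isOdd-count (agrees G o₂ c) positions) ⟩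
    ⨁ positions (agrees G o₁ c) xor ⨁ positions (agrees G o₂ c)
      ≡⟨ ⨁-xor positions (agrees G o₁ c) (agrees G o₂ c) ⟩
    ⨁[ i ← positions ] (agrees G o₁ c i xor agrees G o₂ c i)
      ≡⟨ ⨁-cong positions (agrees-xor o₁ o₂ c pl≢0) ⟩
    ⨁[ i ← positions ] (o₁ (edges c i) xor o₂ (edges c i))
      ≡⟨ ⨁-reindex (edges c) (einj c) (λ e → o₁ e xor o₂ e) ⟩
    ⨁[ e ← allFin (nE G) ] (inCircuit G c e ∧ (o₁ e xor o₂ e)) ∎
    where
    positions : List (Fin (len c))
    positions = allFin (len c)

  module _ {k} (𝒞 : Fin k → Circuit G) where

    isOdd-countClockwiseEven : ∀ o →
      isOdd (countClockwiseEven G o 𝒞) ≡ ⨁[ j ← allFin k ] not (isOdd (forwardCount G o (𝒞 j)))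
    isOdd-countClockwiseEven o =
      trans (isOdd-length-filter _ (allFin k)) (⨁-cong (allFin k) (λ j → does-%2≟0 (forwardCount G o (𝒞 j))))

    isOdd-countClockwiseEven-xor : (∀ j → pl (𝒞 j) ≢ 0) → ∀ (o₁ o₂ : Orientation G) →
      isOdd (countClockwiseEven G o₁ 𝒞) xor isOdd (countClockwiseEven G o₂ 𝒞)
        ≡ ⨁[ e ← allFin (nE G) ] (isOdd (multiplicity G 𝒞 e) ∧ (o₁ e xor o₂ e))
    isOdd-countClockwiseEven-xor pl≢0 o₁ o₂ = begin
      isOdd (countClockwiseEven G o₁ 𝒞) xor isOdd (countClockwiseEven G o₂ 𝒞)
        ≡⟨ cong₂ _xor_ (isOdd-countClockwiseEven o₁) (isOdd-countClockwiseEven o₂) ⟩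
      ⨁[ j ← members ] not (forwardParity o₁ j) xor ⨁[ j ← members ] not (forwardParity o₂ j)
        ≡⟨ ⨁-xor members _ _ ⟩
      ⨁[ j ← members ] (not (forwardParity o₁ j) xor not (forwardParity o₂ j))
        ≡⟨ ⨁-cong members (λ j → xor-annihilates-not (forwardParity o₁ j) (forwardParity o₂ j)) ⟩
      ⨁[ j ← members ] (forwardParity o₁ j xor forwardParity o₂ j)
        ≡⟨ ⨁-cong members (λ j → isOdd-forwardCount-xor o₁ o₂ (𝒞 j) (pl≢0 j)) ⟩
      ⨁[ j ← members ] ⨁[ e ← edgeSet ] (inCircuit G (𝒞 j) e ∧ flipped e)
        ≡⟨ ⨁-comm members edgeSet (λ j e → inCircuit G (𝒞 j) e ∧ flipped e) ⟩
      ⨁[ e ← edgeSet ] ⨁[ j ← members ] (inCircuit G (𝒞 j) e ∧ flipped e)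
        ≡⟨ ⨁-cong edgeSet (λ e → ⨁-∧ʳ members (λ j → inCircuit G (𝒞 j) e) (flipped e)) ⟩
      ⨁[ e ← edgeSet ] (⨁[ j ← members ] inCircuit G (𝒞 j) e ∧ flipped e)
        ≡⟨ ⨁-cong edgeSet (λ e → cong (_∧ flipped e) (isOdd-count (λ j → inCircuit G (𝒞 j) e) members)) ⟨
      ⨁[ e ← edgeSet ] (isOdd (multiplicity G 𝒞 e) ∧ flipped e) ∎
      where
      members : List (Fin k)
      members = allFin k
      edgeSet : List (Fin (nE G))
      edgeSet = allFin (nE G)
      forwardParity : Orientation G → Fin k → Bool
      forwardParity o j = isOdd (forwardCount G o (𝒞 j))
      flipped : Fin (nE G) → Bool
      flipped e = o₁ e xor o₂ e

mainTheorem4 : (G : Graph) → (k : ℕ) → (𝒞 : Fin k → Circuit G)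
    → DistinctMembers G 𝒞
    → (∀ j → IsEven (len (𝒞 j)))
    → SumEmpty G 𝒞
    → (o₁ o₂ : Orientation G)
    → countClockwiseEven G o₁ 𝒞 % 2 ≡ countClockwiseEven G o₂ 𝒞 % 2
mainTheorem4 G k 𝒞 _ evenLengths sumEmpty o₁ o₂ =
  isOdd⇒%2 {countClockwiseEven G o₁ 𝒞} {countClockwiseEven G o₂ 𝒞} (xor≡false⇒≡ (begin
  isOdd (countClockwiseEven G o₁ 𝒞) xor isOdd (countClockwiseEven G o₂ 𝒞)
    ≡⟨ isOdd-countClockwiseEven-xor G 𝒞 (λ j → even-suc⇒≢0 (evenLengths j)) o₁ o₂ ⟩
  ⨁[ e ← allFin (nE G) ] (isOdd (multiplicity G 𝒞 e) ∧ (o₁ e xor o₂ e))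
    ≡⟨ ⨁-cong (allFin (nE G))
         (λ e → cong (_∧ (o₁ e xor o₂ e)) (isOdd≡false {multiplicity G 𝒞 e} (sumEmpty e))) ⟩
  ⨁[ _ ← allFin (nE G) ] false
    ≡⟨ ⨁-zero (allFin (nE G)) ⟩
  false ∎))
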